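{- Let $S_n=K_{1,n}$ be a star on $n+1\ge 4$ vertices. Then $\pi_T(S_n)=n+1$.
   Context: A sequence is nonrepetitive if it contains no block of consecutive terms $r_1\dots r_{2k}$ ($k\ge1$) with $r_i=r_{k+i}$ for all $i$. For a graph $G$, a (strong) total Thue colouring is a colouring $\varphi$ of $V(G)\cup E(G)$ such that for every path $v_0e_1v_1\dots e_kv_k$ in $G$ the three sequences $\varphi(v_0)\varphi(e_1)\varphi(v_1)\dots\varphi(e_k)\varphi(v_k)$, $\varphi(v_0)\varphi(v_1)\dots\varphi(v_k)$ and $\varphi(e_1)\dots\varphi(e_k)$ are all nonrepetitive. $\pi_T(G)$ is the minimum number of colours in a total Thue colouring of $G$. -}

module Defs where

open import Data.Nat using (ℕ; zero; suc; _≤_)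
open import Data.Fin using (Fin; zero; suc)
open import Data.List using (List; []; _∷_; _++_; map)
open import Data.List.Relation.Unary.Unique.Propositional using (Unique)
open import Data.Product using (Σ; ∃; _×_; _,_)
open import Data.Sum using (_⊎_; inj₁; inj₂)
open import Data.Empty using (⊥)
open import Relation.Binary.PropositionalEquality using (_≡_; _≢_)
open import Relation.Nullary using (¬_)

record Graph : Set₁ where
  field
    order   : ℕ
    Adj     : Fin order → Fin order → Set
    sym     : ∀ {u v} → Adj u v → Adj v u
    irrefl  : ∀ {u} → ¬ Adj u u
open Graph public

Repetitive : {A : Set} → List A → Set
Repetitive {A} s = ∃ λ (a : List A) → ∃ λ (r : List A) → ∃ λ (b : List A) →
  (r ≢ []) × (s ≡ a ++ (r ++ (r ++ b)))

Nonrepetitive : {A : Set} → List A → Set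
Nonrepetitive s = ¬ Repetitive s

data IsWalk (G : Graph) : List (Fin (order G)) → Set where
  single : ∀ v → IsWalk G (v ∷ [])
  step   : ∀ {u v rest} → Adj G u v → IsWalk G (v ∷ rest) → IsWalk G (u ∷ v ∷ rest)

IsPath : (G : Graph) → List (Fin (order G)) → Set
IsPath G p = IsWalk G p × Unique p

-- A total colouring with colours Fin k. Edge colours are given by a function
-- on vertex pairs, required to be symmetric on edges (only values on edges matter).
record TotalColouring (G : Graph) (k : ℕ) : Set where
  field
    vcol     : Fin (order G) → Fin k
    ecol     : Fin (order G) → Fin (order G) → Fin k
    ecol-sym : ∀ {u v} → Adj G u v → ecol u v ≡ ecol v u
open TotalColouring public

module _ {G : Graph} {k : ℕ} (c : TotalColouring G k) where
  vertexSeq : List (Fin (order G)) → List (Fin k)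
  vertexSeq = map (vcol c)

  edgeSeq : List (Fin (order G)) → List (Fin k)
  edgeSeq [] = []
  edgeSeq (u ∷ []) = []
  edgeSeq (u ∷ v ∷ rest) = ecol c u v ∷ edgeSeq (v ∷ rest)

  totalSeq : List (Fin (order G)) → List (Fin k)
  totalSeq [] = []
  totalSeq (u ∷ []) = vcol c u ∷ []
  totalSeq (u ∷ v ∷ rest) = vcol c u ∷ ecol c u v ∷ totalSeq (v ∷ rest)

IsTotalThue : {G : Graph} {k : ℕ} → TotalColouring G k → Set
IsTotalThue {G} c = ∀ p → IsPath G p →
  Nonrepetitive (totalSeq c p) × Nonrepetitive (vertexSeq c p) × Nonrepetitive (edgeSeq c p)

TotalThueNumber≡ : Graph → ℕ → Set
TotalThueNumber≡ G m =
  (Σ (TotalColouring G m) IsTotalThue) ×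
  (∀ k → (c : TotalColouring G k) → IsTotalThue c → m ≤ k)

-- The star S_n = K_{1,n}: vertex zero is the centre, leaves 1..n.
StarAdj : (n : ℕ) → Fin (suc n) → Fin (suc n) → Set
StarAdj n u v = (u ≡ zero × v ≢ zero) ⊎ (v ≡ zero × u ≢ zero)

private
  starSym : ∀ {n} {u v : Fin (suc n)} → StarAdj n u v → StarAdj n v u
  starSym (inj₁ (a , b)) = inj₂ (a , b)
  starSym (inj₂ (a , b)) = inj₁ (a , b)

  starIrr : ∀ {n} {u : Fin (suc n)} → ¬ StarAdj n u u
  starIrr (inj₁ (a , b)) = b a
  starIrr (inj₂ (a , b)) = b a

Star : ℕ → Graph
Star n = record { order = suc n ; Adj = StarAdj n ; sym = starSym ; irrefl = starIrr }

module Submission where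

-- The centre's colour and the n edge colours are pairwise distinct: a centre–leaf path
-- would otherwise begin with a square x x in its total sequence, and a leaf–centre–leaf
-- path would have the edge sequence x x.  So at least n + 1 colours are needed.
-- Conversely every path of a star has at most three vertices, so its sequences have
-- length at most five, and a square in them has length two or four.  Colouring the
-- centre 0, the edge to leaf i by i, leaf 1 by 2 and all other leaves by 1 leaves no
-- such square.

open import Defs hiding (sym)
open import Data.Nat using (ℕ; suc; _≤_; s≤s; z≤n; _+_)
open import Data.Nat.Properties using (≤-trans; +-mono-≤; +-monoʳ-≤; m≤m+n; m≤n+m; ≤⇒≯; module ≤-Reasoning)
open import Data.Fin using (Fin; zero; suc; _≟_)
open import Data.Fin.Properties using (injective⇒≤; suc-injective)
open import Data.List using (List; []; _∷_; _++_; length)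
open import Data.List.Properties using (∷-injective; length-++)
open import Data.List.Relation.Unary.All using ([]; _∷_)
open import Data.List.Relation.Unary.AllPairs using ([]; _∷_)
open import Data.List.Relation.Unary.Unique.Propositional using (Unique)
open import Data.Product using (∃₂; _×_; _,_; proj₁; proj₂)
open import Data.Sum using (_⊎_; inj₁; inj₂)
open import Data.Empty using (⊥-elim)
open import Function using (_∘_)
open import Relation.Binary.PropositionalEquality using (_≡_; _≢_; refl; sym; trans; cong)
open import Relation.Nullary using (¬_; yes; no)

module _ {A : Set} where

  SquarePrefix : List A → Set
  SquarePrefix s = ∃₂ λ (r b : List A) → r ≢ [] × s ≡ r ++ r ++ b

  square-prefix-or-repetitive-tail : ∀ {x : A} {s} →
    Repetitive (x ∷ s) → SquarePrefix (x ∷ s) ⊎ Repetitive s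
  square-prefix-or-repetitive-tail ([] , r , b , r≢[] , eq) = inj₁ (r , b , r≢[] , eq)
  square-prefix-or-repetitive-tail (_ ∷ a , r , b , r≢[] , eq) =
    inj₂ (a , r , b , r≢[] , proj₂ (∷-injective eq))

  square-length : ∀ (a r b : List A) → length r + length r ≤ length (a ++ r ++ r ++ b)
  square-length a r b = begin
    length r + length r                           ≤⟨ +-monoʳ-≤ (length r) (m≤m+n (length r) (length b)) ⟩
    length r + (length r + length b)              ≤⟨ m≤n+m _ (length a) ⟩
    length a + (length r + (length r + length b)) ≡⟨ sym length-a++r++r++b ⟩
    length (a ++ r ++ r ++ b)                     ∎
    where
    open ≤-Reasoning
    length-a++r++r++b : length (a ++ r ++ r ++ b) ≡ length a + (length r + (length r + length b))
    length-a++r++r++b = trans (length-++ a) (cong (length a +_)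
      (trans (length-++ r) (cong (length r +_) (length-++ r))))

  repetitive-length : ∀ {s : List A} → Repetitive s → 2 ≤ length s
  repetitive-length (_ , [] , _ , r≢[] , _) = ⊥-elim (r≢[] refl)
  repetitive-length (a , r@(_ ∷ _) , b , _ , refl) =
    ≤-trans (+-mono-≤ (s≤s z≤n) (s≤s z≤n)) (square-length a r b)

  adjacent-repetitive : ∀ {x y : A} {s} → x ≡ y → Repetitive (x ∷ y ∷ s)
  adjacent-repetitive {x} {s = s} refl = [] , x ∷ [] , s , (λ ()) , refl

  nonrepetitive-[] : Nonrepetitive {A} []
  nonrepetitive-[] rep with repetitive-length rep
  ... | ()

  nonrepetitive-singleton : ∀ (x : A) → Nonrepetitive (x ∷ [])
  nonrepetitive-singleton x rep with repetitive-length rep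
  ... | s≤s ()

  -- A square prefix of a list of length at most five has length two or four.
  nonrepetitive-∷∷ : ∀ {x y : A} {s} → length s ≤ 3 → x ≢ y → (∀ t → s ≢ x ∷ y ∷ t) →
    Nonrepetitive (y ∷ s) → Nonrepetitive (x ∷ y ∷ s)
  nonrepetitive-∷∷ short x≢y s≢xy∷ nonrep rep with square-prefix-or-repetitive-tail rep
  ... | inj₂ rep-tail                                = nonrep rep-tail
  ... | inj₁ ([] , _ , r≢[] , _)                     = r≢[] refl
  ... | inj₁ (_ ∷ [] , _ , _ , refl)                 = x≢y refl
  ... | inj₁ (_ ∷ _ ∷ [] , b , _ , refl)             = s≢xy∷ b refl
  ... | inj₁ (r@(_ ∷ _ ∷ _ ∷ _) , b , _ , refl) =
    ≤⇒≯ (≤-trans (square-length [] r b) (s≤s (s≤s short)))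
        (+-mono-≤ (s≤s (s≤s (s≤s z≤n))) (s≤s (s≤s (s≤s z≤n))))

  nonrepetitive₂ : ∀ {x y : A} → x ≢ y → Nonrepetitive (x ∷ y ∷ [])
  nonrepetitive₂ x≢y = nonrepetitive-∷∷ z≤n x≢y (λ _ ()) (nonrepetitive-singleton _)

  nonrepetitive₃ : ∀ {x y z : A} → x ≢ y → y ≢ z → Nonrepetitive (x ∷ y ∷ z ∷ [])
  nonrepetitive₃ x≢y y≢z = nonrepetitive-∷∷ (s≤s z≤n) x≢y (λ _ ()) (nonrepetitive₂ y≢z)

  nonrepetitive₅ : ∀ {x₁ x₂ x₃ x₄ x₅ : A} →
    x₁ ≢ x₂ → x₂ ≢ x₃ → x₃ ≢ x₄ → x₄ ≢ x₅ → x₂ ≢ x₄ →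
    Nonrepetitive (x₁ ∷ x₂ ∷ x₃ ∷ x₄ ∷ x₅ ∷ [])
  nonrepetitive₅ x₁≢x₂ x₂≢x₃ x₃≢x₄ x₄≢x₅ x₂≢x₄ =
    nonrepetitive-∷∷ (s≤s (s≤s (s≤s z≤n))) x₁≢x₂ (λ { _ refl → x₂≢x₄ refl })
      (nonrepetitive-∷∷ (s≤s (s≤s z≤n)) x₂≢x₃ (λ { _ refl → x₂≢x₄ refl })
        (nonrepetitive₃ x₃≢x₄ x₄≢x₅))

data StarEdge {n : ℕ} : Fin (suc n) → Fin (suc n) → Set where
  centre-leaf : ∀ i → StarEdge zero (suc i)
  leaf-centre : ∀ i → StarEdge (suc i) zero

star-edge : ∀ {n} {u v : Fin (suc n)} → StarAdj n u v → StarEdge u v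
star-edge {v = zero}  (inj₁ (refl , v≢0)) = ⊥-elim (v≢0 refl)
star-edge {v = suc i} (inj₁ (refl , _))   = centre-leaf i
star-edge {u = zero}  (inj₂ (refl , u≢0)) = ⊥-elim (u≢0 refl)
star-edge {u = suc i} (inj₂ (refl , _))   = leaf-centre i

star-adj : ∀ {n} {u v : Fin (suc n)} → StarEdge u v → StarAdj n u v
star-adj (centre-leaf i) = inj₁ (refl , λ ())
star-adj (leaf-centre i) = inj₂ (refl , λ ())

data StarPath {n : ℕ} : List (Fin (suc n)) → Set where
  point          : ∀ v → StarPath (v ∷ [])
  edge           : ∀ {u v} → StarEdge u v → StarPath (u ∷ v ∷ [])
  through-centre : ∀ {i j} → i ≢ j → StarPath (suc i ∷ zero ∷ suc j ∷ [])

star-path : ∀ {n p} → IsPath (Star n) p → StarPath p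
star-path (single v , _)             = point v
star-path (step a (single _) , _)    = edge (star-edge a)
star-path (step a (step b walk) , u) = two-edges (star-edge a) (star-edge b) walk u
  where
  two-edges : ∀ {n} {x y z : Fin (suc n)} {rest} → StarEdge x y → StarEdge y z →
    IsWalk (Star n) (z ∷ rest) → Unique (x ∷ y ∷ z ∷ rest) → StarPath (x ∷ y ∷ z ∷ rest)
  two-edges (centre-leaf _) (leaf-centre _) _ ((_ ∷ 0≢0 ∷ _) ∷ _) = ⊥-elim (0≢0 refl)
  two-edges (leaf-centre _) (centre-leaf _) (single _) ((_ ∷ i≢j ∷ []) ∷ _) =
    through-centre (i≢j ∘ cong suc)
  two-edges (leaf-centre _) (centre-leaf _) (step c _) u = ⊥-elim (third-edge (star-edge c) u)
    where
    third-edge : ∀ {n} {i j : Fin n} {w rest} → StarEdge (suc j) w →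
      ¬ Unique (suc i ∷ zero ∷ suc j ∷ w ∷ rest)
    third-edge (leaf-centre _) (_ ∷ (_ ∷ 0≢0 ∷ _) ∷ _) = 0≢0 refl

star-path-isPath : ∀ {n p} → StarPath {n} p → IsPath (Star n) p
star-path-isPath (point v) = single v , [] ∷ []
star-path-isPath (edge e)  = step (star-adj e) (single _) , (ends-distinct e ∷ []) ∷ [] ∷ []
  where
  ends-distinct : ∀ {n} {u v : Fin (suc n)} → StarEdge u v → u ≢ v
  ends-distinct (centre-leaf _) ()
  ends-distinct (leaf-centre _) ()
star-path-isPath (through-centre i≢j) =
  step (star-adj (leaf-centre _)) (step (star-adj (centre-leaf _)) (single _)) ,
  ((λ ()) ∷ (i≢j ∘ suc-injective) ∷ []) ∷ ((λ ()) ∷ []) ∷ [] ∷ []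

star-colours-lower-bound : ∀ {n k} (c : TotalColouring (Star n) k) → IsTotalThue c → suc n ≤ k
star-colours-lower-bound {n} {k} c thue = injective⇒≤ {f = colour} colour-injective
  where
  colour : Fin (suc n) → Fin k
  colour zero    = vcol c zero
  colour (suc i) = ecol c zero (suc i)

  centre≢edge : ∀ i → colour zero ≢ colour (suc i)
  centre≢edge i eq =
    proj₁ (thue _ (star-path-isPath (edge (centre-leaf i)))) (adjacent-repetitive eq)

  colour-injective : ∀ {u v} → colour u ≡ colour v → u ≡ v
  colour-injective {zero}  {zero}  _  = refl
  colour-injective {zero}  {suc j} eq = ⊥-elim (centre≢edge j eq)
  colour-injective {suc i} {zero}  eq = ⊥-elim (centre≢edge i (sym eq))
  colour-injective {suc i} {suc j} eq with i ≟ j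
  ... | yes i≡j = cong suc i≡j
  ... | no i≢j  = ⊥-elim (proj₂ (proj₂ (thue _ (star-path-isPath (through-centre i≢j))))
                    (adjacent-repetitive (trans (ecol-sym c (star-adj (leaf-centre i))) eq)))

module StarColouring (m : ℕ) where

  vertex-colour : Fin (3 + m) → Fin (3 + m)
  vertex-colour zero          = zero
  vertex-colour (suc zero)    = suc (suc zero)
  vertex-colour (suc (suc _)) = suc zero

  edge-colour : Fin (3 + m) → Fin (3 + m) → Fin (3 + m)
  edge-colour zero    v = v
  edge-colour (suc i) _ = suc i

  edge-colour-sym : ∀ {u v} → StarAdj (2 + m) u v → edge-colour u v ≡ edge-colour v u
  edge-colour-sym a with star-edge a
  ... | centre-leaf _ = refl
  ... | leaf-centre _ = refl

  colouring : TotalColouring (Star (2 + m)) (3 + m)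
  colouring = record { vcol = vertex-colour ; ecol = edge-colour ; ecol-sym = edge-colour-sym }

  leaf≢centre : ∀ i → vertex-colour (suc i) ≢ zero
  leaf≢centre zero    ()
  leaf≢centre (suc _) ()

  leaf≢edge : ∀ i → vertex-colour (suc i) ≢ suc i
  leaf≢edge zero    ()
  leaf≢edge (suc _) ()

  nonrepetitive-along : ∀ {p} → StarPath p →
    Nonrepetitive (totalSeq colouring p) × Nonrepetitive (vertexSeq colouring p) ×
    Nonrepetitive (edgeSeq colouring p)
  nonrepetitive-along (point v) =
    nonrepetitive-singleton _ , nonrepetitive-singleton _ , nonrepetitive-[]
  nonrepetitive-along (edge (centre-leaf i)) =
    nonrepetitive₃ (λ ()) (leaf≢edge i ∘ sym) ,
    nonrepetitive₂ (leaf≢centre i ∘ sym) ,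
    nonrepetitive-singleton _
  nonrepetitive-along (edge (leaf-centre i)) =
    nonrepetitive₃ (leaf≢edge i) (λ ()) ,
    nonrepetitive₂ (leaf≢centre i) ,
    nonrepetitive-singleton _
  nonrepetitive-along (through-centre {i} {j} i≢j) =
    nonrepetitive₅ (leaf≢edge i) (λ ()) (λ ()) (leaf≢edge j ∘ sym) (i≢j ∘ suc-injective) ,
    nonrepetitive₃ (leaf≢centre i) (leaf≢centre j ∘ sym) ,
    nonrepetitive₂ (i≢j ∘ suc-injective)

  colouring-isTotalThue : IsTotalThue colouring
  colouring-isTotalThue _ = nonrepetitive-along ∘ star-path

star-totalThueNumber : ∀ m → TotalThueNumber≡ (Star (2 + m)) (3 + m)
star-totalThueNumber m =
  (colouring , colouring-isTotalThue) , λ _ c → star-colours-lower-bound c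
  where open StarColouring m

theorem17 : ∀ (n : ℕ) → 3 ≤ n → TotalThueNumber≡ (Star n) (suc n)
theorem17 (suc (suc (suc m))) (s≤s (s≤s (s≤s _))) = star-totalThueNumber (suc m)
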